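{- If $\vec{B}=(\vec{b}_1;\dots;\vec{b}_k)\in\mathbb{F}_q^{k\times n}$ is an LLL-reduced basis, then for all $1\le i\le k-1$, \[|\vec{b}_{i+1}^+|\ge\left\lceil\frac{|\vec{b}_i^+|}{q}\right\rceil.\]
   Context: $|\vec{x}|$ Hamming weight. $\pi^\perp_{\{\vec{x}_1,\dots,\vec{x}_m\}}$ zeroes coordinates in the union of supports; $\pi_i:=\pi^\perp_{\{\vec{b}_1,\dots,\vec{b}_{i-1}\}}$, $\vec{b}_i^+:=\pi_i(\vec{b}_i)$, $\vec{B}_{[i,j]}:=(\pi_i(\vec{b}_i);\dots;\pi_i(\vec{b}_j))$, with $\vec{B}_{[i,j]}:=\vec{B}_{[i,k]}$ for $j>k$. Forward reduced: first vector is a shortest nonzero codeword of the generated code. LLL-reduced means $2$-BKZ reduced, i.e., $\vec{B}_{[i,i+1]}$ is forward reduced for all $i\in[1,k]$. -}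

module Defs where

open import Level using (0ℓ)
import Data.Nat
import Data.Bool
open import Data.Nat using (ℕ; zero; suc; _+_; _∸_; _≤_; _<_; NonZero)
open import Data.Nat.DivMod using (_/_)
open import Data.Fin using (Fin; toℕ)
open import Data.List using (List; length; filter; foldr; allFin)
open import Data.Bool using (Bool; true; false; if_then_else_; _∧_)
open import Data.Product using (Σ; ∃; _×_; _,_)
open import Relation.Nullary using (¬_; Dec; does; ¬?)
open import Relation.Binary.PropositionalEquality using (_≡_; _≢_)
open import Algebra.Structures using (IsCommutativeRing)
open import Function.Bundles using (_↔_)

record FiniteField (q : ℕ) : Set₁ where
  field
    Carrier : Set
    _+F_    : Carrier → Carrier → Carrier
    _*F_    : Carrier → Carrier → Carrier
    -F_     : Carrier → Carrier
    0F      : Carrier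
    1F      : Carrier
    isCommutativeRing : IsCommutativeRing _≡_ _+F_ _*F_ -F_ 0F 1F
    0≢1     : 0F ≢ 1F
    inverse : ∀ x → x ≢ 0F → Σ Carrier (λ y → x *F y ≡ 1F)
    _≟F_    : (x y : Carrier) → Dec (x ≡ y)
    card    : Carrier ↔ Fin q

⌈_/_⌉ : (m q : ℕ) → .{{NonZero q}} → ℕ
⌈ m / q ⌉ = (m + (q ∸ 1)) / q

module Code {q : ℕ} (F : FiniteField q) where
  open FiniteField F

  Vector : ℕ → Set
  Vector n = Fin n → Carrier

  zeroV : ∀ {n} → Vector n
  zeroV _ = 0F

  IsZero : ∀ {n} → Vector n → Set
  IsZero v = ∀ j → v j ≡ 0F

  weight : ∀ {n} → Vector n → ℕ
  weight {n} v = length (filter (λ j → ¬? (v j ≟F 0F)) (allFin n))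

  -- k × n matrices, given by their rows b_1, ..., b_k (0-based: Fin k)
  Matrix : ℕ → ℕ → Set
  Matrix k n = Fin k → Vector n

  lincomb : ∀ {k n} → (Fin k → Carrier) → Matrix k n → Vector n
  lincomb {k} c rows j = foldr (λ r acc → (c r *F rows r j) +F acc) 0F (allFin k)

  LinearlyIndependent : ∀ {k n} → Matrix k n → Set
  LinearlyIndependent B = ∀ c → IsZero (lincomb c B) → ∀ r → c r ≡ 0F

  -- is coordinate j in the union of the supports of the rows b_l with l < i
  -- (0-based indices), i.e. of b_1, ..., b_{i} in 1-based numbering?
  covered : ∀ {k n} → Matrix k n → ℕ → Fin n → Bool
  covered {k} B i j =
    foldr (λ l acc → (does (Data.Nat._<?_ (toℕ l) i) ∧ Data.Bool.not (does (B l j ≟F 0F)))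
                     Data.Bool.∨ acc)
          false (allFin k)

  -- π_i : zeroes the coordinates in the union of supports of the rows of
  -- B preceding row i (0-based row i = paper's b_{i+1}, so this is the
  -- paper's π_{i+1} = π^⊥_{b_1,...,b_i}).
  proj : ∀ {k n} → Matrix k n → Fin k → Vector n → Vector n
  proj B i v j = if covered B (toℕ i) j then 0F else v j

  epi : ∀ {k n} → Matrix k n → Fin k → Vector n
  epi B i = proj B i (B i)

  -- The projected block B_[i,j] = (π_i(b_i); ...; π_i(b_j)), where j is
  -- capped at the last index (convention B_[i,j] := B_[i,k] for j > k).
  -- Represented as a k-row matrix whose rows outside [i, j] are zero
  -- (this does not change the generated code).
  block : ∀ {k n} → Matrix k n → Fin k → ℕ → Matrix k n
  block B i j r =
    if does (Data.Nat._≤?_ (toℕ i) (toℕ r)) ∧ does (Data.Nat._≤?_ (toℕ r) j)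
    then proj B i (B r) else zeroV

  Codeword : ∀ {k n} → Matrix k n → Vector n → Set
  Codeword {k} M v = Σ (Fin k → Carrier) (λ c → ∀ j → v j ≡ lincomb c M j)

  ForwardReduced : ∀ {k n} → Matrix k n → Fin k → ℕ → Set
  ForwardReduced B i j =
    ¬ IsZero (epi B i) ×
    (∀ v → Codeword (block B i j) v → ¬ IsZero v → weight (epi B i) ≤ weight v)

  -- LLL-reduced = 2-BKZ reduced: B_[i,i+1] forward reduced for all i ∈ [1,k]
  -- (0-based: all i : Fin k, block [i, i+1], capped at the last index)
  LLLReduced : ∀ {k n} → Matrix k n → Set
  LLLReduced B = ∀ i → ForwardReduced B i (suc (toℕ i))

-- Let e = b_i^+ and p = π_i(b_{i+1}). For every scalar γ the vector p − γe is a codeword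
-- of the block B_[i,i+1]; it is nonzero, since off the support of e it agrees with
-- b_{i+1}^+ ≠ 0. Writing z(γ) for the number of coordinates of supp e on which p − γe
-- vanishes, |p − γe| = |b_{i+1}^+| + |e| − z(γ), so forward reducedness (|e| ≤ |p − γe|)
-- gives z(γ) ≤ |b_{i+1}^+|. Every coordinate of supp e is cancelled by exactly one γ,
-- namely p_j / e_j, hence |e| ≤ Σ_γ z(γ) ≤ q |b_{i+1}^+|.

module Submission where

open import Defs
open import Data.Nat using (ℕ; suc; _≥_; NonZero)
open import Data.Fin using (Fin; toℕ)
open import Relation.Binary.PropositionalEquality using (_≡_)

open import Level using (0ℓ)
open import Algebra.Bundles using (CommutativeMonoid; RawMonoid; CommutativeRing)
import Algebra.Definitions.RawMonoid as RawMonoidDefinitions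
import Algebra.Properties.CommutativeMonoid.Sum as CommutativeMonoidSum
open import Data.Bool using (true; false; if_then_else_; T; _∧_; _∨_; not)
open import Data.Bool.Properties using (T-∧)
open import Data.Empty using (⊥-elim)
open import Data.Fin.Properties
  using (toℕ-injective; punchInᵢ≢i; punchIn-punchOut; punchIn-injective)
import Data.Fin as Fin
open import Data.List using (length; filter; foldr; tabulate; allFin)
open import Data.Bool.ListAction using (any)
open import Data.List.Properties using (foldr-map)
open import Data.List.Membership.Propositional using (lose)
open import Data.List.Membership.Propositional.Properties using (∈-allFin)
open import Data.List.Relation.Unary.Any using (satisfied)
open import Data.List.Relation.Unary.Any.Properties using (any⁺; any⁻)
open import Data.Nat using (zero; _+_; _*_; _≤_; _<_; z≤n; _<?_; _≤?_)
import Data.Nat.Properties as ℕₚ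
open import Data.Nat.DivMod using (m<n*o⇒m/o<n)
open import Data.Product using (∃; _×_; _,_; proj₁)
open import Data.Sum using (_⊎_; inj₁; inj₂; [_,_])
open import Function using (_∘_; _$_; _⇔_; mk⇔; Equivalence; Inverse)
open import Relation.Nullary using (¬_; Dec; yes; no; does; ¬?)
open import Relation.Nullary.Decidable using (dec-true; dec-false; T?)
open import Relation.Binary.PropositionalEquality
  using (_≢_; refl; sym; trans; cong; cong₂; subst; module ≡-Reasoning)

module _ {c ℓ} (M : RawMonoid c ℓ) where
  open RawMonoid M
  open RawMonoidDefinitions M using () renaming (sum to ∑)

  foldr-tabulate : ∀ {a} {A : Set a} (g : A → Carrier) {n} (h : Fin n → A) →
    foldr (λ x acc → g x ∙ acc) ε (tabulate h) ≡ ∑ (g ∘ h)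
  foldr-tabulate g {zero}  h = refl
  foldr-tabulate g {suc n} h = cong (g (h Fin.zero) ∙_) (foldr-tabulate g (h ∘ Fin.suc))

module _ {c ℓ} (M : CommutativeMonoid c ℓ) where
  open CommutativeMonoid M using (Carrier; _≈_; _∙_; ε; ∙-congˡ; identityʳ; setoid)
  open CommutativeMonoidSum M using (sum; sum-cong-≋; sum-replicate-zero; sum-remove)
  open import Relation.Binary.Reasoning.Setoid setoid

  ∑-zero : ∀ {n} (f : Fin n → Carrier) → (∀ r → f r ≈ ε) → sum f ≈ ε
  ∑-zero {n} f f≈ε = begin
    sum f            ≈⟨ sum-cong-≋ f≈ε ⟩
    sum {n} (λ _ → ε) ≈⟨ sum-replicate-zero n ⟩
    ε                ∎

  ∑-single : ∀ {n} (f : Fin n → Carrier) a → (∀ r → r ≢ a → f r ≈ ε) → sum f ≈ f a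
  ∑-single {suc n} f a f≈ε = begin
    sum f                               ≈⟨ sum-remove f ⟩
    f a ∙ sum (f ∘ Fin.punchIn a)       ≈⟨ ∙-congˡ (∑-zero _ (λ r → f≈ε _ (punchInᵢ≢i a r))) ⟩
    f a ∙ ε                             ≈⟨ identityʳ (f a) ⟩
    f a                                 ∎

  ∑-pair : ∀ {n} (f : Fin n → Carrier) a b → a ≢ b →
           (∀ r → r ≢ a → r ≢ b → f r ≈ ε) → sum f ≈ f a ∙ f b
  ∑-pair {suc n} f a b a≢b f≈ε = begin
    sum f                                   ≈⟨ sum-remove f ⟩
    f a ∙ sum (f ∘ Fin.punchIn a)           ≈⟨ ∙-congˡ (∑-single _ (Fin.punchOut a≢b) off-b) ⟩
    f a ∙ f (Fin.punchIn a (Fin.punchOut a≢b)) ≡⟨ cong (λ r → f a ∙ f r) (punchIn-punchOut a≢b) ⟩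
    f a ∙ f b                               ∎
    where
    off-b : ∀ r → r ≢ Fin.punchOut a≢b → f (Fin.punchIn a r) ≈ ε
    off-b r r≢b = f≈ε _ (punchInᵢ≢i a r) λ eq →
      r≢b (punchIn-injective a r _ (trans eq (sym (punchIn-punchOut a≢b))))

module ℕ-Sum = CommutativeMonoidSum ℕₚ.+-0-commutativeMonoid
open ℕ-Sum using (sum; sum-syntax; ∑-distrib-+; ∑-comm; sum-remove)

indicator : ∀ {a} {A : Set a} → Dec A → ℕ
indicator a? = if does a? then 1 else 0

module _ {a} {A : Set a} where

  indicator-yes : (a? : Dec A) → A → indicator a? ≡ 1
  indicator-yes a? x rewrite dec-true a? x = refl

  indicator-no : (a? : Dec A) → ¬ A → indicator a? ≡ 0
  indicator-no a? ¬x rewrite dec-false a? ¬x = refl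

  indicator-¬?+indicator : (a? : Dec A) → indicator (¬? a?) + indicator a? ≡ 1
  indicator-¬?+indicator (yes _) = refl
  indicator-¬?+indicator (no _)  = refl

  T-does⇔ : (a? : Dec A) → T (does a?) ⇔ A
  T-does⇔ (yes a) = mk⇔ (λ _ → a) _
  T-does⇔ (no ¬a) = mk⇔ (λ ()) ¬a

  T-not-does⇔ : (a? : Dec A) → T (not (does a?)) ⇔ (¬ A)
  T-not-does⇔ (yes a)  = mk⇔ (λ ()) (λ ¬a → ¬a a)
  T-not-does⇔ (no ¬a) = mk⇔ (λ _ → ¬a) _

length-filter-tabulate : ∀ {a p} {A : Set a} {P : A → Set p} (P? : ∀ x → Dec (P x))
  {n} (h : Fin n → A) → length (filter P? (tabulate h)) ≡ ∑[ r < n ] indicator (P? (h r))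
length-filter-tabulate P? {zero} h = refl
length-filter-tabulate P? {suc n} h with P? (h Fin.zero)
... | yes _ = cong suc (length-filter-tabulate P? (h ∘ Fin.suc))
... | no _  = length-filter-tabulate P? (h ∘ Fin.suc)

∑-mono-≤ : ∀ {n} {f g : Fin n → ℕ} → (∀ r → f r ≤ g r) → sum f ≤ sum g
∑-mono-≤ {zero} f≤g = z≤n
∑-mono-≤ {suc n}  f≤g = ℕₚ.+-mono-≤ (f≤g Fin.zero) (∑-mono-≤ (f≤g ∘ Fin.suc))

term≤∑ : ∀ {n} (f : Fin n → ℕ) r → f r ≤ sum f
term≤∑ {suc n} f r = subst (f r ≤_) (sym (sum-remove f)) (ℕₚ.m≤m+n (f r) _)

∑-const : ∀ n c → ∑[ r < n ] c ≡ n * c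
∑-const zero  c = refl
∑-const (suc n) c = cong (c +_) (∑-const n c)

m≤o*n⇒⌈m/o⌉≤n : ∀ {m n} o .{{_ : NonZero o}} → m ≤ o * n → ⌈ m / o ⌉ ≤ n
m≤o*n⇒⌈m/o⌉≤n {m} {n} (suc o) m≤o*n = ℕₚ.≤-pred (m<n*o⇒m/o<n (begin-strict
  m + o         <⟨ ℕₚ.+-monoʳ-< m (ℕₚ.n<1+n o) ⟩
  m + suc o     ≤⟨ ℕₚ.+-monoˡ-≤ (suc o) m≤o*n ⟩
  suc o * n + suc o ≡⟨ cong (_+ suc o) (ℕₚ.*-comm (suc o) n) ⟩
  n * suc o + suc o ≡⟨ ℕₚ.+-comm (n * suc o) (suc o) ⟩
  suc n * suc o ∎))
  where open ℕₚ.≤-Reasoning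

if-T : ∀ {a} {A : Set a} b {x y : A} → T b → (if b then x else y) ≡ x
if-T true _ = refl

if-¬T : ∀ {a} {A : Set a} b {x y : A} → ¬ T b → (if b then x else y) ≡ y
if-¬T false _  = refl
if-¬T true  ¬t = ⊥-elim (¬t _)

module _ {q : ℕ} (F : FiniteField q) where
  open FiniteField F
  open Code F

  commutativeRing : CommutativeRing 0ℓ 0ℓ
  commutativeRing = record { isCommutativeRing = isCommutativeRing }

  open CommutativeRing commutativeRing
    using ( +-commutativeMonoid; +-rawMonoid; +-identityʳ; +-comm; *-assoc; *-comm
          ; *-identityˡ; *-identityʳ; zeroˡ; zeroʳ; -‿inverseʳ; ring)
  open import Algebra.Properties.Ring ring using (-‿distribˡ-*)
  open RawMonoidDefinitions +-rawMonoid using () renaming (sum to ∑F)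

  χ≢0 χ≡0 : Carrier → ℕ
  χ≢0 x = indicator (¬? (x ≟F 0F))
  χ≡0 x = indicator (x ≟F 0F)

  χ≢0-zero : ∀ {x} → x ≡ 0F → χ≢0 x ≡ 0
  χ≢0-zero {x} x≡0 = indicator-no (¬? (x ≟F 0F)) (λ x≢0 → x≢0 x≡0)

  χ≢0-nonzero : ∀ {x} → x ≢ 0F → χ≢0 x ≡ 1
  χ≢0-nonzero {x} = indicator-yes (¬? (x ≟F 0F))

  χ≡0-zero : ∀ {x} → x ≡ 0F → χ≡0 x ≡ 1
  χ≡0-zero {x} = indicator-yes (x ≟F 0F)

  χ≢0+χ≡0 : ∀ x → χ≢0 x + χ≡0 x ≡ 1
  χ≢0+χ≡0 x = indicator-¬?+indicator (x ≟F 0F)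

  weight≡∑ : ∀ {n} (v : Vector n) → weight v ≡ ∑[ j < n ] χ≢0 (v j)
  weight≡∑ v = length-filter-tabulate (λ j → ¬? (v j ≟F 0F)) (λ j → j)

  weight-cong : ∀ {n} {u v : Vector n} → (∀ j → u j ≡ v j) → weight u ≡ weight v
  weight-cong {u = u} {v} u≗v = begin
    weight u                 ≡⟨ weight≡∑ u ⟩
    ∑[ j < _ ] χ≢0 (u j)     ≡⟨ ℕ-Sum.sum-cong-≗ (cong χ≢0 ∘ u≗v) ⟩
    ∑[ j < _ ] χ≢0 (v j)     ≡⟨ weight≡∑ v ⟨
    weight v                 ∎
    where open ≡-Reasoning

  π⊥ : ∀ {n} → Vector n → Vector n → Vector n
  π⊥ x w j = if does (x j ≟F 0F) then w j else 0F

  _-[_]_ : ∀ {n} → Vector n → Carrier → Vector n → Vector n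
  (w -[ γ ] x) j = w j +F (-F (γ *F x j))

  module _ {n} (x w : Vector n) {j : Fin n} where

    π⊥-off : x j ≡ 0F → π⊥ x w j ≡ w j
    π⊥-off x≡0 rewrite dec-true (x j ≟F 0F) x≡0 = refl

    π⊥-on : x j ≢ 0F → π⊥ x w j ≡ 0F
    π⊥-on x≢0 rewrite dec-false (x j ≟F 0F) x≢0 = refl

    -[]-off : ∀ γ → x j ≡ 0F → (w -[ γ ] x) j ≡ w j
    -[]-off γ x≡0 = begin
      w j +F (-F (γ *F x j))   ≡⟨ cong (λ y → w j +F (-F (γ *F y))) x≡0 ⟩
      w j +F (-F (γ *F 0F))    ≡⟨ cong (w j +F_) (-‿distribˡ-* γ 0F) ⟩
      w j +F ((-F γ) *F 0F)    ≡⟨ cong (w j +F_) (zeroʳ (-F γ)) ⟩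
      w j +F 0F                ≡⟨ +-identityʳ (w j) ⟩
      w j                      ∎
      where open ≡-Reasoning

  cancelling-scalar : ∀ x y → x ≢ 0F → ∃ λ γ → y +F (-F (γ *F x)) ≡ 0F
  cancelling-scalar x y x≢0 with inverse x x≢0
  ... | x⁻¹ , xx⁻¹≡1 = y *F x⁻¹ , (begin
    y +F (-F ((y *F x⁻¹) *F x))   ≡⟨ cong (λ z → y +F (-F z)) y/x*x≡y ⟩
    y +F (-F y)                   ≡⟨ -‿inverseʳ y ⟩
    0F                            ∎)
    where
    open ≡-Reasoning
    y/x*x≡y : (y *F x⁻¹) *F x ≡ y
    y/x*x≡y = begin
      (y *F x⁻¹) *F x   ≡⟨ *-assoc y x⁻¹ x ⟩
      y *F (x⁻¹ *F x)   ≡⟨ cong (y *F_) (trans (*-comm x⁻¹ x) xx⁻¹≡1) ⟩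
      y *F 1F           ≡⟨ *-identityʳ y ⟩
      y                 ∎

  module _ {n} (x w : Vector n) where

    cancels : Fin n → Carrier → ℕ
    cancels j γ = χ≢0 (x j) * χ≡0 ((w -[ γ ] x) j)

    cancelCount : Carrier → ℕ
    cancelCount γ = ∑[ j < n ] cancels j γ

    weight-pencil : ∀ γ → weight (w -[ γ ] x) + cancelCount γ ≡ weight (π⊥ x w) + weight x
    weight-pencil γ = begin
      weight v + cancelCount γ
        ≡⟨ cong (_+ cancelCount γ) (weight≡∑ v) ⟩
      ∑[ j < n ] χ≢0 (v j) + cancelCount γ
        ≡⟨ ∑-distrib-+ {n} _ _ ⟨
      ∑[ j < n ] (χ≢0 (v j) + cancels j γ)
        ≡⟨ ℕ-Sum.sum-cong-≗ (λ j → coordinatewise j (x j ≟F 0F)) ⟩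
      ∑[ j < n ] (χ≢0 (π⊥ x w j) + χ≢0 (x j))
        ≡⟨ ∑-distrib-+ {n} _ _ ⟩
      ∑[ j < n ] χ≢0 (π⊥ x w j) + ∑[ j < n ] χ≢0 (x j)
        ≡⟨ cong₂ _+_ (weight≡∑ (π⊥ x w)) (weight≡∑ x) ⟨
      weight (π⊥ x w) + weight x
        ∎
      where
      open ≡-Reasoning
      v : Vector n
      v = w -[ γ ] x
      coordinatewise : ∀ j → Dec (x j ≡ 0F) →
        χ≢0 (v j) + cancels j γ ≡ χ≢0 (π⊥ x w j) + χ≢0 (x j)
      coordinatewise j (yes x≡0) = begin
        χ≢0 (v j) + χ≢0 (x j) * χ≡0 (v j)
          ≡⟨ cong (λ c → χ≢0 (v j) + c * χ≡0 (v j)) (χ≢0-zero x≡0) ⟩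
        χ≢0 (v j) + 0
          ≡⟨ cong (λ y → χ≢0 y + 0) (-[]-off x w γ x≡0) ⟩
        χ≢0 (w j) + 0
          ≡⟨ cong₂ (λ y c → χ≢0 y + c) (π⊥-off x w x≡0) (χ≢0-zero x≡0) ⟨
        χ≢0 (π⊥ x w j) + χ≢0 (x j)
          ∎
      coordinatewise j (no x≢0) = begin
        χ≢0 (v j) + χ≢0 (x j) * χ≡0 (v j)
          ≡⟨ cong (λ c → χ≢0 (v j) + c * χ≡0 (v j)) (χ≢0-nonzero x≢0) ⟩
        χ≢0 (v j) + 1 * χ≡0 (v j)
          ≡⟨ cong (χ≢0 (v j) +_) (ℕₚ.*-identityˡ (χ≡0 (v j))) ⟩
        χ≢0 (v j) + χ≡0 (v j)
          ≡⟨ χ≢0+χ≡0 (v j) ⟩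
        1
          ≡⟨ cong (_+ 1) (χ≢0-zero refl) ⟨
        χ≢0 0F + 1
          ≡⟨ cong₂ (λ y c → χ≢0 y + c) (π⊥-on x w x≢0) (χ≢0-nonzero x≢0) ⟨
        χ≢0 (π⊥ x w j) + χ≢0 (x j)
          ∎

    open Inverse card using (to; from; strictlyInverseʳ)

    support-cancelled : ∀ j → Dec (x j ≡ 0F) → χ≢0 (x j) ≤ ∑[ t < q ] cancels j (from t)
    support-cancelled j (yes x≡0) = ℕₚ.≤-trans (ℕₚ.≤-reflexive (χ≢0-zero x≡0)) z≤n
    support-cancelled j (no x≢0) with cancelling-scalar (x j) (w j) x≢0
    ... | γ , w-γx≡0 = begin
      χ≢0 (x j)                  ≡⟨ ℕₚ.*-identityʳ (χ≢0 (x j)) ⟨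
      χ≢0 (x j) * 1              ≡⟨ cong (χ≢0 (x j) *_) (χ≡0-zero w-γx≡0) ⟨
      cancels j γ                ≡⟨ cong (cancels j) (strictlyInverseʳ γ) ⟨
      cancels j (from (to γ))    ≤⟨ term≤∑ (cancels j ∘ from) (to γ) ⟩
      ∑[ t < q ] cancels j (from t) ∎
      where open ℕₚ.≤-Reasoning

    pencil-bound : (∀ γ → weight x ≤ weight (w -[ γ ] x)) → weight x ≤ q * weight (π⊥ x w)
    pencil-bound x-shortest = begin
      weight x                                  ≡⟨ weight≡∑ x ⟩
      ∑[ j < n ] χ≢0 (x j)                      ≤⟨ ∑-mono-≤ (λ j → support-cancelled j (x j ≟F 0F)) ⟩
      ∑[ j < n ] ∑[ t < q ] cancels j (from t)  ≡⟨ ∑-comm (λ j t → cancels j (from t)) ⟩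
      ∑[ t < q ] cancelCount (from t)           ≤⟨ ∑-mono-≤ (λ t → cancelCount≤ (from t)) ⟩
      ∑[ t < q ] weight (π⊥ x w)                ≡⟨ ∑-const q (weight (π⊥ x w)) ⟩
      q * weight (π⊥ x w)                       ∎
      where
      open ℕₚ.≤-Reasoning
      cancelCount≤ : ∀ γ → cancelCount γ ≤ weight (π⊥ x w)
      cancelCount≤ γ = ℕₚ.+-cancelˡ-≤ (weight x) _ _ (begin
        weight x + cancelCount γ              ≤⟨ ℕₚ.+-monoˡ-≤ _ (x-shortest γ) ⟩
        weight (w -[ γ ] x) + cancelCount γ   ≡⟨ weight-pencil γ ⟩
        weight (π⊥ x w) + weight x            ≡⟨ ℕₚ.+-comm (weight (π⊥ x w)) (weight x) ⟩
        weight x + weight (π⊥ x w)            ∎)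

    pencil-nonzero : ∀ γ → ¬ IsZero (π⊥ x w) → ¬ IsZero (w -[ γ ] x)
    pencil-nonzero γ π⊥≢0 v≡0 = π⊥≢0 (λ j → π⊥-vanishes j (x j ≟F 0F))
      where
      π⊥-vanishes : ∀ j → Dec (x j ≡ 0F) → π⊥ x w j ≡ 0F
      π⊥-vanishes j (yes x≡0) = trans (π⊥-off x w x≡0) (trans (sym (-[]-off x w γ x≡0)) (v≡0 j))
      π⊥-vanishes j (no x≢0)  = π⊥-on x w x≢0

  lincomb≡∑ : ∀ {k n} c (M : Matrix k n) j → lincomb c M j ≡ ∑F (λ r → c r *F M r j)
  lincomb≡∑ c M j = foldr-tabulate +-rawMonoid (λ r → c r *F M r j) (λ r → r)

  twoPoint : ∀ {k} → Fin k → Carrier → Fin k → Carrier → Fin k → Carrier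
  twoPoint a α b β r = if does (r Fin.≟ a) then α else if does (r Fin.≟ b) then β else 0F

  lincomb-twoPoint : ∀ {k n} (M : Matrix k n) {a b} α β → a ≢ b → ∀ j →
    lincomb (twoPoint a α b β) M j ≡ (α *F M a j) +F (β *F M b j)
  lincomb-twoPoint {k} M {a} {b} α β a≢b j = begin
    lincomb (twoPoint a α b β) M j  ≡⟨ lincomb≡∑ (twoPoint a α b β) M j ⟩
    ∑F f                            ≡⟨ ∑-pair +-commutativeMonoid f a b a≢b off-support ⟩
    f a +F f b                      ≡⟨ cong₂ _+F_ (cong (_*F M a j) at-a) (cong (_*F M b j) at-b) ⟩
    (α *F M a j) +F (β *F M b j)    ∎
    where
    open ≡-Reasoning
    f : Fin k → Carrier
    f r = twoPoint a α b β r *F M r j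
    off-support : ∀ r → r ≢ a → r ≢ b → f r ≡ 0F
    off-support r r≢a r≢b
      rewrite dec-false (r Fin.≟ a) r≢a | dec-false (r Fin.≟ b) r≢b = zeroˡ (M r j)
    at-a : twoPoint a α b β a ≡ α
    at-a rewrite dec-true (a Fin.≟ a) refl = refl
    at-b : twoPoint a α b β b ≡ β
    at-b rewrite dec-false (b Fin.≟ a) (a≢b ∘ sym) | dec-true (b Fin.≟ b) refl = refl

  module _ {k n} (B : Matrix k n) where

    covered≡any : ∀ m j →
      covered B m j ≡ any (λ l → does (toℕ l <? m) ∧ not (does (B l j ≟F 0F))) (allFin k)
    covered≡any m j = sym (foldr-map _∨_ _ false (allFin k))

    covered⁺ : ∀ {m j} l → toℕ l < m → B l j ≢ 0F → T (covered B m j)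
    covered⁺ {m} {j} l l<m B≢0 = subst T (sym (covered≡any m j))
      (any⁺ _ (lose (∈-allFin l) (Equivalence.from T-∧
        (Equivalence.from (T-does⇔ (toℕ l <? m)) l<m ,
         Equivalence.from (T-not-does⇔ (B l j ≟F 0F)) B≢0))))

    covered⁻ : ∀ {m j} → T (covered B m j) → ∃ λ l → toℕ l < m × B l j ≢ 0F
    covered⁻ {m} {j} c =
      let l , Tl = satisfied (any⁻ _ (allFin k) (subst T (covered≡any m j) c))
          l<m , B≢0 = Equivalence.to T-∧ Tl
      in l , Equivalence.to (T-does⇔ (toℕ l <? m)) l<m ,
             Equivalence.to (T-not-does⇔ (B l j ≟F 0F)) B≢0

    covered-suc : ∀ i j → T (covered B (suc (toℕ i)) j) ⇔ (T (covered B (toℕ i) j) ⊎ B i j ≢ 0F)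
    covered-suc i j = mk⇔ split join
      where
      split : T (covered B (suc (toℕ i)) j) → T (covered B (toℕ i) j) ⊎ B i j ≢ 0F
      split c with covered⁻ c
      ... | l , l<1+i , B≢0 with ℕₚ.m<1+n⇒m<n∨m≡n l<1+i
      ...   | inj₁ l<i = inj₁ (covered⁺ l l<i B≢0)
      ...   | inj₂ l≡i = inj₂ (subst (λ r → B r j ≢ 0F) (toℕ-injective l≡i) B≢0)
      join : T (covered B (toℕ i) j) ⊎ B i j ≢ 0F → T (covered B (suc (toℕ i)) j)
      join (inj₁ c) with covered⁻ c
      ... | l , l<i , B≢0 = covered⁺ l (ℕₚ.m<n⇒m<1+n l<i) B≢0
      join (inj₂ B≢0) = covered⁺ i ℕₚ.≤-refl B≢0

    proj-covered : ∀ i (w : Vector n) j → T (covered B (toℕ i) j) → proj B i w j ≡ 0F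
    proj-covered i w j = if-T (covered B (toℕ i) j)

    proj-uncovered : ∀ i (w : Vector n) j → ¬ T (covered B (toℕ i) j) → proj B i w j ≡ w j
    proj-uncovered i w j = if-¬T (covered B (toℕ i) j)

    epi-suc : ∀ {i i'} → toℕ i' ≡ suc (toℕ i) →
              ∀ j → epi B i' j ≡ π⊥ (epi B i) (proj B i (B i')) j
    epi-suc {i} {i'} i'≡1+i j = by-cases (T? (covered B (toℕ i) j)) (B i j ≟F 0F)
      where
      open ≡-Reasoning
      e p : Vector n
      e = epi B i
      p = proj B i (B i')
      covered-i' : T (covered B (toℕ i') j) ⇔ (T (covered B (toℕ i) j) ⊎ B i j ≢ 0F)
      covered-i' = subst (λ m → T (covered B m j) ⇔ _) (sym i'≡1+i) (covered-suc i j)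
      by-cases : Dec (T (covered B (toℕ i) j)) → Dec (B i j ≡ 0F) → epi B i' j ≡ π⊥ e p j
      by-cases (yes c) _ = begin
        epi B i' j  ≡⟨ proj-covered i' (B i') j (Equivalence.from covered-i' (inj₁ c)) ⟩
        0F          ≡⟨ proj-covered i (B i') j c ⟨
        p j         ≡⟨ π⊥-off e p (proj-covered i (B i) j c) ⟨
        π⊥ e p j    ∎
      by-cases (no ¬c) (yes B≡0) = begin
        epi B i' j  ≡⟨ proj-uncovered i' (B i') j ([ ¬c , (_$ B≡0) ] ∘ Equivalence.to covered-i') ⟩
        B i' j      ≡⟨ proj-uncovered i (B i') j ¬c ⟨
        p j         ≡⟨ π⊥-off e p (trans (proj-uncovered i (B i) j ¬c) B≡0) ⟨
        π⊥ e p j    ∎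
      by-cases (no ¬c) (no B≢0) = begin
        epi B i' j  ≡⟨ proj-covered i' (B i') j (Equivalence.from covered-i' (inj₂ B≢0)) ⟩
        0F          ≡⟨ π⊥-on e p (B≢0 ∘ trans (sym (proj-uncovered i (B i) j ¬c))) ⟨
        π⊥ e p j    ∎

    block-row : ∀ {i r} l → toℕ i ≤ toℕ r → toℕ r ≤ l → ∀ j → block B i l r j ≡ proj B i (B r) j
    block-row {i} {r} l i≤r r≤l j
      rewrite dec-true (toℕ i ≤? toℕ r) i≤r | dec-true (toℕ r ≤? l) r≤l = refl

    pencil-in-block : ∀ {i i'} → toℕ i' ≡ suc (toℕ i) → ∀ γ →
      Codeword (block B i (suc (toℕ i))) (proj B i (B i') -[ γ ] epi B i)
    pencil-in-block {i} {i'} i'≡1+i γ = twoPoint i (-F γ) i' 1F , λ j → begin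
      p j +F (-F (γ *F e j))
        ≡⟨ +-comm (p j) _ ⟩
      (-F (γ *F e j)) +F p j
        ≡⟨ cong₂ _+F_ (-‿distribˡ-* γ (e j)) (sym (*-identityˡ (p j))) ⟩
      ((-F γ) *F e j) +F (1F *F p j)
        ≡⟨ cong₂ (λ y z → ((-F γ) *F y) +F (1F *F z)) (row-i j) (row-i' j) ⟨
      ((-F γ) *F blk i j) +F (1F *F blk i' j)
        ≡⟨ lincomb-twoPoint blk (-F γ) 1F i≢i' j ⟨
      lincomb (twoPoint i (-F γ) i' 1F) blk j
        ∎
      where
      open ≡-Reasoning
      e p : Vector n
      e = epi B i
      p = proj B i (B i')
      blk : Matrix k n
      blk = block B i (suc (toℕ i))
      i≢i' : i ≢ i'
      i≢i' i≡i' = ℕₚ.<-irrefl (trans (cong toℕ i≡i') i'≡1+i) (ℕₚ.n<1+n (toℕ i))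
      row-i : ∀ j → blk i j ≡ e j
      row-i = block-row _ ℕₚ.≤-refl (ℕₚ.n≤1+n (toℕ i))
      row-i' : ∀ j → blk i' j ≡ p j
      row-i' = block-row _ (ℕₚ.≤-trans (ℕₚ.n≤1+n (toℕ i)) (ℕₚ.≤-reflexive (sym i'≡1+i)))
                           (ℕₚ.≤-reflexive i'≡1+i)

  epi-weight-bound : ∀ {k n} (B : Matrix k n) {i i'} → toℕ i' ≡ suc (toℕ i) →
    ForwardReduced B i (suc (toℕ i)) → ¬ IsZero (epi B i') →
    weight (epi B i) ≤ q * weight (epi B i')
  epi-weight-bound {n = n} B {i} {i'} i'≡1+i (_ , shortest) e'≢0 = begin
    weight e                ≤⟨ pencil-bound e p (λ γ → shortest _ (pencil-in-block B i'≡1+i γ)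
                                                  (pencil-nonzero e p γ π⊥≢0)) ⟩
    q * weight (π⊥ e p)     ≡⟨ cong (q *_) (weight-cong (epi-suc B i'≡1+i)) ⟨
    q * weight (epi B i')   ∎
    where
    open ℕₚ.≤-Reasoning
    e p : Vector n
    e = epi B i
    p = proj B i (B i')
    π⊥≢0 : ¬ IsZero (π⊥ e p)
    π⊥≢0 π⊥≡0 = e'≢0 (λ j → trans (epi-suc B i'≡1+i j) (π⊥≡0 j))

mainTheorem13 : (q : ℕ) .{{_ : NonZero q}} (F : FiniteField q) (k n : ℕ)
    (B : Code.Matrix F k n) →
    Code.LinearlyIndependent F B →
    Code.LLLReduced F B →
    (i i' : Fin k) → toℕ i' ≡ suc (toℕ i) →
    Code.weight F (Code.epi F B i') ≥ ⌈ Code.weight F (Code.epi F B i) / q ⌉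
mainTheorem13 q F k n B _ lll i i' i'≡1+i =
  m≤o*n⇒⌈m/o⌉≤n q (epi-weight-bound F B i'≡1+i (lll i) (proj₁ (lll i')))
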